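{- Let $k$ be a positive integer, let $G$ be a graph with at least one vertex and $S\subseteq V(G)$. If $\operatorname{tn}(G,S)\geq k$, then $\operatorname{tw}(G,S)\geq k-1$.
   Context: A separation of $G$ is a pair $(A,B)$ of subgraphs of $G$ with $A\cup B=G$ and $E(A\cap B)=\emptyset$; its order is $|V(A)\cap V(B)|$. A tangle of order $k$ in $G$ is a family $\mathcal T$ of separations of $G$ of order less than $k$ such that: (T1) for every separation $(A,B)$ of order at most $k-1$, $(A,B)\in\mathcal T$ or $(B,A)\in\mathcal T$; (T2) for all $(A_1,B_1),(A_2,B_2),(A_3,B_3)\in\mathcal T$, $A_1\cup A_2\cup A_3\neq G$; (T3) for every $(A,B)\in\mathcal T$, $V(A)\ne V(G)$. It is a tangle of $(G,S)$ if moreover (T4) for every $(A,B)\in\mathcal T$, $S\not\subseteq V(A)$. $\operatorname{tn}(G,S)$ is the maximum order of a tangle of $(G,S)$. A tree decomposition of a graph $H$ is a pair $(T,(W_x\mid x\in V(T)))$ with $T$ a non-null tree and bags $W_x\subseteq V(H)$ such that each edge of $H$ lies in some bag and for each vertex $v$ the set $\{x: v\in W_x\}$ induces a non-empty subtree; its width is $\max_x|W_x|-1$. A tree decomposition of $(G,S)$ is a tree decomposition of some induced subgraph $H$ of $G$ with $S\subseteq V(H)$ such that for every component $C$ of $G-V(H)$ some bag contains all neighbours of $V(C)$ in $G$; $\operatorname{tw}(G,S)$ is the minimum width of such a decomposition. -}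

module Defs where

open import Data.Nat using (ℕ; zero; suc; _≤_; _<_; _⊔_; _∸_)
open import Data.Fin using (Fin)
open import Data.Fin.Subset using (Subset; _∈_; _∉_; _⊆_; _∩_; ∣_∣)
open import Data.Bool using (Bool; true; false)
open import Data.List using (List; []; _∷_; map; foldr; allFin)
open import Data.List.Relation.Unary.Unique.Propositional using (Unique)
open import Data.Product using (Σ; ∃; _×_; _,_)
open import Data.Sum using (_⊎_)
open import Data.Unit using (⊤)
open import Relation.Nullary using (¬_)
open import Relation.Binary.PropositionalEquality using (_≡_)

record Graph (n : ℕ) : Set where
  field
    adj      : Fin n → Fin n → Bool
    adj-sym  : ∀ u v → adj u v ≡ adj v u
    adj-irr  : ∀ v → adj v v ≡ false
open Graph public

data WalkIn {m : ℕ} (R : Fin m → Fin m → Bool) (P : Fin m → Set)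
            : Fin m → Fin m → Set where
  here : ∀ {x} → P x → WalkIn R P x x
  step : ∀ {x y z} → P x → R x y ≡ true → WalkIn R P y z → WalkIn R P x z

ConnectedIn : {m : ℕ} → (Fin m → Fin m → Bool) → (Fin m → Set) → Set
ConnectedIn R P = ∀ x y → P x → P y → WalkIn R P x y

Chain : {m : ℕ} → (Fin m → Fin m → Bool) → List (Fin m) → Set
Chain R []           = ⊤
Chain R (x ∷ [])     = ⊤
Chain R (x ∷ y ∷ xs) = (R x y ≡ true) × Chain R (y ∷ xs)

lastOf : {m : ℕ} → Fin m → List (Fin m) → Fin m
lastOf z []       = z
lastOf z (w ∷ ws) = lastOf w ws

HasCycle : {m : ℕ} → (Fin m → Fin m → Bool) → Set
HasCycle R = Σ _ λ x → Σ _ λ y → Σ _ λ z → Σ (List _) λ rest →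
  Unique (x ∷ y ∷ z ∷ rest) × Chain R (x ∷ y ∷ z ∷ rest)
  × R (lastOf z rest) x ≡ true

record Tree : Set where
  field
    size     : ℕ
    tadj     : Fin (suc size) → Fin (suc size) → Bool
    tadj-sym : ∀ x y → tadj x y ≡ tadj y x
    tadj-irr : ∀ x → tadj x x ≡ false
    connected : ConnectedIn tadj (λ _ → ⊤)
    acyclic   : ¬ HasCycle tadj
open Tree public

Node : Tree → Set
Node T = Fin (suc (size T))

record Sub (n : ℕ) : Set where
  constructor sub
  field
    vs : Subset n
    es : Fin n → Fin n → Bool
open Sub public

module _ {n : ℕ} (G : Graph n) where

  IsSubgraph : Sub n → Set
  IsSubgraph A =
      (∀ u v → es A u v ≡ es A v u)
    × (∀ u v → es A u v ≡ true → adj G u v ≡ true)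
    × (∀ u v → es A u v ≡ true → (u ∈ vs A) × (v ∈ vs A))

  IsSeparation : Sub n → Sub n → Set
  IsSeparation A B =
      IsSubgraph A × IsSubgraph B
    × (∀ v → (v ∈ vs A) ⊎ (v ∈ vs B))
    × (∀ u v → adj G u v ≡ true → (es A u v ≡ true) ⊎ (es B u v ≡ true))
    × (∀ u v → ¬ ((es A u v ≡ true) × (es B u v ≡ true)))

  order : Sub n → Sub n → ℕ
  order A B = ∣ vs A ∩ vs B ∣

  Covers3 : Sub n → Sub n → Sub n → Set
  Covers3 A₁ A₂ A₃ =
      (∀ v → (v ∈ vs A₁) ⊎ (v ∈ vs A₂) ⊎ (v ∈ vs A₃))
    × (∀ u v → adj G u v ≡ true →
         (es A₁ u v ≡ true) ⊎ (es A₂ u v ≡ true) ⊎ (es A₃ u v ≡ true))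

  IsTangleOf : Subset n → ℕ → (Sub n → Sub n → Set) → Set
  IsTangleOf S k 𝒯 =
      (∀ A B → 𝒯 A B → IsSeparation A B × order A B < k)
    × (∀ A B → IsSeparation A B → order A B ≤ k ∸ 1 → 𝒯 A B ⊎ 𝒯 B A)
    × (∀ A₁ B₁ A₂ B₂ A₃ B₃ → 𝒯 A₁ B₁ → 𝒯 A₂ B₂ → 𝒯 A₃ B₃ →
         ¬ Covers3 A₁ A₂ A₃)
    × (∀ A B → 𝒯 A B → ¬ (∀ v → v ∈ vs A))
    × (∀ A B → 𝒯 A B → ¬ (S ⊆ vs A))

  TnAtLeast : Subset n → ℕ → Set₁
  TnAtLeast S k = Σ ℕ λ k' → (k ≤ k') × Σ (Sub n → Sub n → Set) λ 𝒯 → IsTangleOf S k' 𝒯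

  ReachOutside : Subset n → Fin n → Fin n → Set
  ReachOutside X v w = WalkIn (adj G) (λ x → x ∉ X) v w

  -- tree decomposition of (G , S): a tree decomposition of the induced
  -- subgraph H = G[X] with S ⊆ X, such that for every component C of
  -- G - X (i.e. the set of vertices reachable from some v ∉ X in G - X)
  -- some bag contains all neighbours of V(C) in G.
  record TreeDecomp (S : Subset n) : Set₁ where
    field
      X       : Subset n
      S⊆X     : S ⊆ X
      tree    : Tree
      bag     : Node tree → Subset n
      bag⊆X   : ∀ t → bag t ⊆ X
      edgeCov : ∀ u v → u ∈ X → v ∈ X → adj G u v ≡ true →
                  ∃ λ t → (u ∈ bag t) × (v ∈ bag t)
      vtxNonempty : ∀ v → v ∈ X → ∃ λ t → v ∈ bag t
      vtxConn     : ∀ v → v ∈ X → ConnectedIn (tadj tree) (λ t → v ∈ bag t)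
      compNbrs : ∀ v → v ∉ X → ∃ λ t → ∀ u →
                   (∃ λ w → ReachOutside X v w × (¬ (ReachOutside X v u))
                          × adj G w u ≡ true) → u ∈ bag t

  width : {S : Subset n} → TreeDecomp S → ℕ
  width D = foldr _⊔_ 0 (map (λ t → ∣ bag t ∣) (allFin (suc (size tree)))) ∸ 1
    where open TreeDecomp D

  TwAtLeast : Subset n → ℕ → Set₁
  TwAtLeast S k = (D : TreeDecomp S) → k ≤ width D

module Submission where

-- Suppose every bag has fewer than k vertices.  A tree edge st induces a
-- separation (A_st , B_st) of order at most |W_s ∩ W_t| < k, where A_st consists
-- of the vertices in bags on the s-side of st and the components of G − V(H)
-- attached to them outside W_t.  If the tangle does not make A_st small it makes
-- B_st small, and then A_ts, which lies inside B_st, is small by (T2).  Moving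
-- from a node s to a neighbour x whenever A_xs is not small therefore ends, the
-- tree being finite and acyclic, at a node t with A_st small for every
-- neighbour s.  These sides, together with the components of G − V(H) whose
-- neighbourhood lies in W_t (small by (T4), as S ⊆ V(H)), cover V(G) ∖ W_t;
-- merging them one at a time with (T2) gives a small side A with V(A) = V(G),
-- contradicting (T3).

open import Defs
open import Level using (0ℓ)
open import Function using (_∘_; id)
open import Function.Bundles using (mk⇔)
open import Data.Bool using (Bool; true)
open import Data.Bool.Properties using () renaming (_≟_ to _≟ᵇ_)
open import Data.Empty using (⊥; ⊥-elim)
open import Data.Unit using (tt)
open import Data.Nat using (ℕ; zero; suc; _≤_; _∸_; _⊔_; _≤?_)
open import Data.Nat.Properties using (≤-trans; ≰⇒>; m≤m⊔n; m≤n⊔m; m≤n+m∸n; ∸-monoˡ-≤)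
open import Data.Fin using (Fin; zero; suc; _≟_)
open import Data.Fin.Properties using (any?; all?)
open import Data.Fin.Subset using (Subset; _∈_; _∉_; _⊆_; _⊂_; _-_; ∣_∣)
open import Data.Fin.Subset.Induction using (Acc; acc; ⊂-wellFounded)
open import Data.Fin.Subset.Properties
  using (_∈?_; x∈p∩q⁻; p⊆q⇒∣p∣≤∣q∣; x∈p⇒p-x⊂p; x∈p∧x≢y⇒x∈p-y)
open import Data.List using (List; []; _∷_; foldr; filter; allFin)
open import Data.List.Membership.Propositional using (lose) renaming (_∈_ to _∈ₗ_)
open import Data.List.Membership.Propositional.Properties using (∈-allFin; ∈-map⁺; ∈-filter⁺)
open import Data.List.Relation.Unary.All as All using (All; []; _∷_)
open import Data.List.Relation.Unary.All.Properties using (¬Any⇒All¬; all-filter)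
open import Data.List.Relation.Unary.Any as Any using (here; there)
open import Data.List.Relation.Unary.AllPairs using ([]; _∷_)
open import Data.List.Relation.Unary.Unique.Propositional using (Unique)
open import Data.Product using (∃; _×_; _,_; proj₁; proj₂)
open import Data.Sum as Sum using (_⊎_; inj₁; inj₂; [_,_]′)
open import Data.Vec using (tabulate)
open import Data.Vec.Properties using (lookup∘tabulate; []=⇒lookup; lookup⇒[]=)
open import Relation.Nullary using (¬_; Dec; yes; no; ¬?; does)
open import Relation.Nullary.Decidable
  using (dec-true; decidable-stable; does-⇔; map′; _×-dec_; _⊎-dec_; _→-dec_)
open import Relation.Unary using (Pred; Decidable; _∪_; ∁)
open import Relation.Unary.Properties using (∁?; _∪?_)
open import Relation.Binary.PropositionalEquality using (_≡_; _≢_; refl; sym; trans; subst)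

does≡true⇒ : {A : Set} (a? : Dec A) → does a? ≡ true → A
does≡true⇒ (yes a) _  = a
does≡true⇒ (no _)  ()

⟦_⟧ : {m : ℕ} {P : Pred (Fin m) 0ℓ} → Decidable P → Subset m
⟦ P? ⟧ = tabulate (does ∘ P?)

module _ {m : ℕ} {P : Pred (Fin m) 0ℓ} (P? : Decidable P) where

  ∈⟦⟧⁺ : ∀ {x} → P x → x ∈ ⟦ P? ⟧
  ∈⟦⟧⁺ {x} p = lookup⇒[]= x ⟦ P? ⟧ (trans (lookup∘tabulate (does ∘ P?) x) (dec-true (P? x) p))

  ∈⟦⟧⁻ : ∀ {x} → x ∈ ⟦ P? ⟧ → P x
  ∈⟦⟧⁻ {x} x∈P = does≡true⇒ (P? x) (trans (sym (lookup∘tabulate (does ∘ P?) x)) ([]=⇒lookup x∈P))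

all⊎∃ : {m : ℕ} {A B : Pred (Fin m) 0ℓ} → (∀ x → A x ⊎ B x) → (∀ x → A x) ⊎ ∃ B
all⊎∃ {zero}  _ = inj₁ λ ()
all⊎∃ {suc m} f with f zero | all⊎∃ (f ∘ suc)
... | inj₂ b | _            = inj₂ (zero , b)
... | inj₁ _ | inj₂ (x , b) = inj₂ (suc x , b)
... | inj₁ a | inj₁ as      = inj₁ λ { zero → a ; (suc x) → as x }

≤-foldr-⊔ : ∀ {x xs} → x ∈ₗ xs → x ≤ foldr _⊔_ 0 xs
≤-foldr-⊔ (here refl) = m≤m⊔n _ _
≤-foldr-⊔ (there x∈xs) = ≤-trans (≤-foldr-⊔ x∈xs) (m≤n⊔m _ _)

-- Walks

_∖_ : {m : ℕ} → Pred (Fin m) 0ℓ → Fin m → Pred (Fin m) 0ℓ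
(P ∖ c) x = P x × x ≢ c

module _ {m : ℕ} {R : Fin m → Fin m → Bool} where

  private
    variable
      P Q : Pred (Fin m) 0ℓ
      a b c : Fin m

  head∈ : WalkIn R P a b → P a
  head∈ (here p)     = p
  head∈ (step p _ _) = p

  last∈ : WalkIn R P a b → P b
  last∈ (here p)     = p
  last∈ (step _ _ w) = last∈ w

  weaken : (∀ {x} → P x → Q x) → WalkIn R P a b → WalkIn R Q a b
  weaken f (here p)     = here (f p)
  weaken f (step p r w) = step (f p) r (weaken f w)

  _++_ : WalkIn R P a b → WalkIn R P b c → WalkIn R P a c
  here _     ++ w′ = w′
  step p r w ++ w′ = step p r (w ++ w′)

  reverse : (∀ x y → R x y ≡ R y x) → WalkIn R P a b → WalkIn R P b a
  reverse R-sym (here p) = here p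
  reverse R-sym (step {x} {y} p r w) =
    reverse R-sym w ++ step (head∈ w) (trans (R-sym y x) r) (here p)

  prefix⊎avoiding : ∀ c → WalkIn R P a b → WalkIn R P a c ⊎ WalkIn R (P ∖ c) a b
  prefix⊎avoiding c (here {x} p) with x ≟ c
  ... | yes refl = inj₁ (here p)
  ... | no x≢c   = inj₂ (here (p , x≢c))
  prefix⊎avoiding c (step {x} p r w) with x ≟ c
  ... | yes refl = inj₁ (here p)
  ... | no x≢c   = Sum.map (step p r) (step (p , x≢c) r) (prefix⊎avoiding c w)

  -- The part of a walk to b after its last visit to c.
  Exit : Pred (Fin m) 0ℓ → Fin m → Fin m → Set
  Exit P c b = c ≡ b ⊎ ∃ λ y → R c y ≡ true × WalkIn R (P ∖ c) y b

  exit⊎avoiding : ∀ c → WalkIn R P a b → Exit P c b ⊎ WalkIn R (P ∖ c) a b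
  exit⊎avoiding c (here {x} p) with x ≟ c
  ... | yes refl = inj₁ (inj₁ refl)
  ... | no x≢c   = inj₂ (here (p , x≢c))
  exit⊎avoiding c (step {x} {y} p r w) with exit⊎avoiding c w
  ... | inj₁ exit = inj₁ exit
  ... | inj₂ w′ with x ≟ c
  ...   | yes refl = inj₁ (inj₂ (y , r , w′))
  ...   | no x≢c   = inj₂ (step (p , x≢c) r w′)

  last-exit : WalkIn R P a b → Exit P a b
  last-exit w = [ id , (λ w′ → ⊥-elim (proj₂ (head∈ w′) refl)) ]′ (exit⊎avoiding _ w)

  walk∈? : (A : Subset m) → Acc _⊂_ A → ∀ a b → Dec (WalkIn R (_∈ A) a b)
  walk∈? A (acc smaller) a b with a ∈? A
  ... | no a∉A = no (a∉A ∘ head∈)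
  ... | yes a∈A with a ≟ b
  ...   | yes refl = yes (here a∈A)
  ...   | no a≢b   = map′ extend shorten
          (any? λ y → (R a y ≟ᵇ true) ×-dec walk∈? (A - a) (smaller A-a⊂A) y b)
    where
    A-a⊂A : A - a ⊂ A
    A-a⊂A = x∈p⇒p-x⊂p a∈A

    extend : (∃ λ y → R a y ≡ true × WalkIn R (_∈ A - a) y b) → WalkIn R (_∈ A) a b
    extend (y , r , w) = step a∈A r (weaken (proj₁ A-a⊂A) w)

    shorten : WalkIn R (_∈ A) a b → ∃ λ y → R a y ≡ true × WalkIn R (_∈ A - a) y b
    shorten w with last-exit w
    ... | inj₁ a≡b          = ⊥-elim (a≢b a≡b)
    ... | inj₂ (y , r , w′) = y , r , weaken (λ (x∈A , x≢a) → x∈p∧x≢y⇒x∈p-y x∈A x≢a) w′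

  walk? : Decidable P → ∀ a b → Dec (WalkIn R P a b)
  walk? P? a b = map′ (weaken (∈⟦⟧⁻ P?)) (weaken (∈⟦⟧⁺ P?))
                      (walk∈? ⟦ P? ⟧ (⊂-wellFounded _) a b)

  record Path (P : Pred (Fin m) 0ℓ) (a b : Fin m) : Set where
    constructor path
    field
      rest   : List (Fin m)
      unique : Unique (a ∷ rest)
      chain  : Chain R (a ∷ rest)
      inside : All P (a ∷ rest)
      ends   : lastOf a rest ≡ b

  suffix : (p : Path P c b) → a ∈ₗ c ∷ Path.rest p → Path P a b
  suffix p (here refl) = p
  suffix (path (_ ∷ rest) (_ ∷ u) (_ , ch) (_ ∷ ps) e) (there a∈) = suffix (path rest u ch ps e) a∈

  walk⇒path : WalkIn R P a b → Path P a b
  walk⇒path (here p) = path [] ([] ∷ []) tt (p ∷ []) refl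
  walk⇒path {a = a} (step {y = y} p r w) with walk⇒path w
  ... | q@(path rest u ch ps e) with Any.any? (a ≟_) (y ∷ rest)
  ...   | yes a∈ = suffix q a∈
  ...   | no a∉  = path (y ∷ rest) (¬Any⇒All¬ _ a∉ ∷ u) (r , ch) (p ∷ ps) e

-- Trees

module TreeSides (T : Tree) where

  private
    variable
      s t x y : Node T

  _⌢_ : Node T → Node T → Set
  s ⌢ t = tadj T s t ≡ true

  _⌢?_ : ∀ s t → Dec (s ⌢ t)
  s ⌢? t = tadj T s t ≟ᵇ true

  ⌢-sym : s ⌢ t → t ⌢ s
  ⌢-sym {s} {t} st = trans (tadj-sym T t s) st

  ⌢⇒≢ : s ⌢ t → s ≢ t
  ⌢⇒≢ {s} st refl with trans (sym st) (tadj-irr T s)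
  ... | ()

  Side : Node T → Node T → Pred (Node T) 0ℓ
  Side s t = WalkIn (tadj T) (_≢ t) s

  side? : ∀ s t → Decidable (Side s t)
  side? s t = walk? (λ z → ¬? (z ≟ t)) s

  -- A longer path from s to x avoiding t, closed up through t, would be a cycle.
  side∧⌢⇒≡ : s ⌢ t → Side s t x → x ⌢ t → x ≡ s
  side∧⌢⇒≡ st sx xt with walk⇒path sx
  ... | path [] _ _ _ e = sym e
  ... | path (y ∷ rest) u ch ps e = ⊥-elim (acyclic T
          (_ , _ , y , rest , All.map (_∘ sym) ps ∷ u , (⌢-sym st , ch) , subst (_⌢ _) (sym e) xt))

  sides-disjoint : s ⌢ t → Side s t x → ¬ Side t s x
  sides-disjoint st sx tx with last-exit tx
  ... | inj₁ refl = last∈ sx refl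
  ... | inj₂ (y , ty , yx) = proj₁ (head∈ yx)
          (side∧⌢⇒≡ st (sx ++ reverse (tadj-sym T) (weaken proj₂ yx)) (⌢-sym ty))

  side⊆side : s ⌢ t → x ⌢ s → x ≢ t → Side x s y → Side s t y
  side⊆side st xs x≢t xy with prefix⊎avoiding _ xy
  ... | inj₁ xt  = ⊥-elim (x≢t (sym (side∧⌢⇒≡ xs xt (⌢-sym st))))
  ... | inj₂ xy′ = step (⌢⇒≢ st) (⌢-sym xs) (weaken proj₂ xy′)

  side-shrinks : s ⌢ t → x ⌢ s → x ≢ t → ⟦ side? x s ⟧ ⊂ ⟦ side? s t ⟧
  side-shrinks {s} {t} {x} st xs x≢t =
      (λ h → ∈⟦⟧⁺ (side? s t) (side⊆side st xs x≢t (∈⟦⟧⁻ (side? x s) h)))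
    , s , ∈⟦⟧⁺ (side? s t) (here (⌢⇒≢ st)) , λ h → last∈ (∈⟦⟧⁻ (side? x s) h) refl

  ≡⊎side : ∀ t x → x ≡ t ⊎ ∃ λ s → t ⌢ s × Side s t x
  ≡⊎side t x with last-exit (connected T t x tt tt)
  ... | inj₁ t≡x = inj₁ (sym t≡x)
  ... | inj₂ (s , ts , sx) = inj₂ (s , ts , weaken proj₂ sx)

  module _ {P : Node T → Node T → Set} (orient : ∀ {s t} → s ⌢ t → P s t ⊎ P t s) where

    IsSink : Node T → Set
    IsSink t = ∀ s → s ⌢ t → P s t

    -- Step from s to a neighbour x ≠ t whenever P s x; the side ahead shrinks.
    private
      next : ∀ s t x → (x ⌢ s → x ≢ t → P x s) ⊎ (x ⌢ s × x ≢ t × P s x)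
      next s t x with x ⌢? s | x ≟ t
      ... | no ¬xs | _        = inj₁ λ xs → ⊥-elim (¬xs xs)
      ... | yes _  | yes x≡t  = inj₁ λ _ x≢t → ⊥-elim (x≢t x≡t)
      ... | yes xs | no x≢t   = Sum.map (λ xs′ _ _ → xs′) (λ sx → xs , x≢t , sx) (orient xs)

      sink-beyond : s ⌢ t → P t s → Acc _⊂_ ⟦ side? s t ⟧ → ∃ IsSink
      sink-beyond {s} {t} st ts (acc smaller) with all⊎∃ (next s t)
      ... | inj₂ (x , xs , x≢t , sx) = sink-beyond xs sx (smaller (side-shrinks st xs x≢t))
      ... | inj₁ inward = s , into-s
        where
        into-s : IsSink s
        into-s x xs with x ≟ t
        ... | yes refl = ts
        ... | no x≢t   = inward x xs x≢t

    sink : ∃ IsSink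
    sink with any? (_⌢? zero)
    ... | no isolated = zero , λ s s0 → ⊥-elim (isolated (s , s0))
    ... | yes (s , s0) =
      [ (λ p → sink-beyond (⌢-sym s0) p (⊂-wellFounded _))
      , (λ p → sink-beyond s0 p (⊂-wellFounded _)) ]′ (orient s0)

-- Separations

-- A cut (Y , Z) stands for the pair (A , B) with V(A) = Y ∪ Z, V(B) = V(G) ∖ Y,
-- and each edge in A or B according to whether it meets Y.  This is a
-- separation when every edge leaving Y ends in Z, and then V(A) ∩ V(B) ⊆ Z.
record Cut (n : ℕ) : Set₁ where
  constructor cut
  field
    {Interior Boundary} : Pred (Fin n) 0ℓ
    interior? : Decidable Interior
    boundary? : Decidable Boundary
open Cut public

module Separations {n : ℕ} (G : Graph n) where

  private
    variable
      u v : Fin n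

  _~_ : Fin n → Fin n → Set
  u ~ v = adj G u v ≡ true

  ~-sym : u ~ v → v ~ u
  ~-sym {u} {v} uv = trans (adj-sym G v u) uv

  _~?_ : ∀ u v → Dec (u ~ v)
  u ~? v = adj G u v ≟ᵇ true

  decSub : {V : Pred (Fin n) 0ℓ} {E : Fin n → Fin n → Set} →
           Decidable V → (∀ u v → Dec (E u v)) → Sub n
  decSub V? E? = sub ⟦ V? ⟧ (λ u v → does (E? u v))

  decSub-subgraph : {V : Pred (Fin n) 0ℓ} {E : Fin n → Fin n → Set}
    (V? : Decidable V) (E? : ∀ u v → Dec (E u v)) →
    (∀ {u v} → E u v → E v u) → (∀ {u v} → E u v → u ~ v × V u × V v) →
    IsSubgraph G (decSub V? E?)
  decSub-subgraph V? E? E-sym E⇒ =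
      (λ u v → does-⇔ (mk⇔ E-sym E-sym) (E? u v) (E? v u))
    , (λ u v e → proj₁ (E⇒ (does≡true⇒ (E? u v) e)))
    , (λ u v e → let (_ , Vu , Vv) = E⇒ (does≡true⇒ (E? u v) e) in ∈⟦⟧⁺ V? Vu , ∈⟦⟧⁺ V? Vv)

  BoundedBy : Cut n → Subset n → Set
  BoundedBy C W = ∀ {v} → Boundary C v → v ∈ W

  module _ (C : Cut n) where

    Closed : Set
    Closed = ∀ {u v} → u ~ v → Interior C u → Interior C v ⊎ Boundary C v

    Touching Avoiding : Fin n → Fin n → Set
    Touching u v = u ~ v × (Interior C u ⊎ Interior C v)
    Avoiding u v = u ~ v × ¬ (Interior C u ⊎ Interior C v)

    touching? : ∀ u v → Dec (Touching u v)
    touching? u v = (u ~? v) ×-dec (interior? C u ⊎-dec interior? C v)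

    avoiding? : ∀ u v → Dec (Avoiding u v)
    avoiding? u v = (u ~? v) ×-dec ¬? (interior? C u ⊎-dec interior? C v)

    inner-vertices? : Decidable (Interior C ∪ Boundary C)
    inner-vertices? = interior? C ∪? boundary? C

    outer-vertices? : Decidable (∁ (Interior C) ∪ Boundary C)
    outer-vertices? = ∁? (interior? C) ∪? boundary? C

    inner outer : Sub n
    inner = decSub inner-vertices? touching?
    outer = decSub outer-vertices? avoiding?

    inner-vertex : Interior C v ⊎ Boundary C v → v ∈ vs inner
    inner-vertex = ∈⟦⟧⁺ inner-vertices?

    outer-vertex : ¬ Interior C v ⊎ Boundary C v → v ∈ vs outer
    outer-vertex = ∈⟦⟧⁺ outer-vertices?

    inner-edge : Touching u v → es inner u v ≡ true
    inner-edge {u} {v} = dec-true (touching? u v)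

    outer-edge : Avoiding u v → es outer u v ≡ true
    outer-edge {u} {v} = dec-true (avoiding? u v)

    touching-ends : Closed → Touching u v →
                    (Interior C u ⊎ Boundary C u) × (Interior C v ⊎ Boundary C v)
    touching-ends closed (uv , inj₁ iu) = inj₁ iu , closed uv iu
    touching-ends closed (uv , inj₂ iv) = closed (~-sym uv) iv , inj₁ iv

    cut-separation : Closed → IsSeparation G inner outer
    cut-separation closed =
        decSub-subgraph inner-vertices? touching? (λ (uv , i) → ~-sym uv , Sum.swap i)
                        (λ t@(uv , _) → uv , touching-ends closed t)
      , decSub-subgraph outer-vertices? avoiding? (λ (uv , ¬i) → ~-sym uv , ¬i ∘ Sum.swap)
                        (λ (uv , ¬i) → uv , inj₁ (¬i ∘ inj₁) , inj₁ (¬i ∘ inj₂))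
      , vertices , edges
      , λ u v (e₁ , e₂) →
          proj₂ (does≡true⇒ (avoiding? u v) e₂) (proj₂ (does≡true⇒ (touching? u v) e₁))
      where
      vertices : ∀ v → v ∈ vs inner ⊎ v ∈ vs outer
      vertices v with interior? C v
      ... | yes i = inj₁ (inner-vertex (inj₁ i))
      ... | no ¬i = inj₂ (outer-vertex (inj₁ ¬i))

      edges : ∀ u v → u ~ v → es inner u v ≡ true ⊎ es outer u v ≡ true
      edges u v uv with interior? C u ⊎-dec interior? C v
      ... | yes i = inj₁ (inner-edge (uv , i))
      ... | no ¬i = inj₂ (outer-edge (uv , ¬i))

    cut-order≤ : (W : Subset n) → BoundedBy C W → order G inner outer ≤ ∣ W ∣
    cut-order≤ W bounded = p⊆q⇒∣p∣≤∣q∣ λ v∈A∩B →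
      let (v∈A , v∈B) = x∈p∩q⁻ (vs inner) (vs outer) v∈A∩B
      in bounded (in-both (∈⟦⟧⁻ inner-vertices? v∈A) (∈⟦⟧⁻ outer-vertices? v∈B))
      where
      in-both : Interior C v ⊎ Boundary C v → ¬ Interior C v ⊎ Boundary C v → Boundary C v
      in-both _        (inj₂ b)  = b
      in-both (inj₂ b) _         = b
      in-both (inj₁ i) (inj₁ ¬i) = ⊥-elim (¬i i)

  module _ {I : Set} (C₀ : Cut n) (C : I → Cut n) where

    ⋃-cut : List I → Subset n → Cut n
    ⋃-cut is W = cut (λ v → interior? C₀ v ⊎-dec Any.any? (λ i → interior? (C i) v) is) (_∈? W)

    ⋃-closed : ∀ {is W} → Closed C₀ × BoundedBy C₀ W →
               All (λ i → Closed (C i) × BoundedBy (C i) W) is → Closed (⋃-cut is W)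
    ⋃-closed (closed , bounded) _ uv (inj₁ i) =
      Sum.map inj₁ bounded (closed uv i)
    ⋃-closed _ ((closed , bounded) ∷ _) uv (inj₂ (here i)) =
      Sum.map (inj₂ ∘ here) bounded (closed uv i)
    ⋃-closed fit₀ (_ ∷ fits) uv (inj₂ (there i)) =
      Sum.map₁ (Sum.map₂ there) (⋃-closed fit₀ fits uv (inj₂ i))

-- Tangles

module TangleFacts {n : ℕ} (G : Graph n) (S : Subset n) (k : ℕ) (𝒯 : Sub n → Sub n → Set)
                   (tangle : IsTangleOf G S k 𝒯) where

  open Separations G

  private
    variable
      A₁ B₁ A₂ B₂ : Sub n

    T1 : ∀ A B → IsSeparation G A B → order G A B ≤ k ∸ 1 → 𝒯 A B ⊎ 𝒯 B A
    T1 = proj₁ (proj₂ tangle)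

    T2 : ∀ A₁ B₁ A₂ B₂ A₃ B₃ → 𝒯 A₁ B₁ → 𝒯 A₂ B₂ → 𝒯 A₃ B₃ → ¬ Covers3 G A₁ A₂ A₃
    T2 = proj₁ (proj₂ (proj₂ tangle))

    T3 : ∀ A B → 𝒯 A B → ¬ (∀ v → v ∈ vs A)
    T3 = proj₁ (proj₂ (proj₂ (proj₂ tangle)))

    T4 : ∀ A B → 𝒯 A B → ¬ (S ⊆ vs A)
    T4 = proj₂ (proj₂ (proj₂ (proj₂ tangle)))

  Small Big : Cut n → Set
  Small C = 𝒯 (inner C) (outer C)
  Big   C = 𝒯 (outer C) (inner C)

  ¬small-spanning : ∀ C → Small C → ¬ (∀ v → Interior C v ⊎ Boundary C v)
  ¬small-spanning C small spanning = T3 _ _ small (inner-vertex C ∘ spanning)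

  module _ (W : Subset n) (|W|≤ : ∣ W ∣ ≤ k ∸ 1) where

    small⊎big : ∀ C → Closed C → BoundedBy C W → Small C ⊎ Big C
    small⊎big C closed bounded =
      T1 _ _ (cut-separation C closed) (≤-trans (cut-order≤ C W bounded) |W|≤)

    small-if-avoids-S : ∀ C → Closed C → BoundedBy C W → (∀ {v} → v ∈ S → ¬ Interior C v) → Small C
    small-if-avoids-S C closed bounded avoids with small⊎big C closed bounded
    ... | inj₁ small = small
    ... | inj₂ big   = ⊥-elim (T4 _ _ big (outer-vertex C ∘ inj₁ ∘ avoids))

    small-if-covered : ∀ C → 𝒯 A₁ B₁ → 𝒯 A₂ B₂ → Closed C → BoundedBy C W →
      (∀ {v} → Interior C v → v ∈ vs A₁ ⊎ v ∈ vs A₂) →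
      (∀ {u v} → Touching C u v → es A₁ u v ≡ true ⊎ es A₂ u v ≡ true) →
      Small C
    small-if-covered {A₁ = A₁} {A₂ = A₂} C t₁ t₂ closed bounded cover-vertices cover-edges
      with small⊎big C closed bounded
    ... | inj₁ small = small
    ... | inj₂ big   = ⊥-elim (T2 _ _ _ _ _ _ t₁ t₂ big (vertices , edges))
      where
      vertices : ∀ v → v ∈ vs A₁ ⊎ v ∈ vs A₂ ⊎ v ∈ vs (outer C)
      vertices v with interior? C v
      ... | yes i = Sum.assocʳ (inj₁ (cover-vertices i))
      ... | no ¬i = inj₂ (inj₂ (outer-vertex C (inj₁ ¬i)))

      edges : ∀ u v → u ~ v → es A₁ u v ≡ true ⊎ es A₂ u v ≡ true ⊎ es (outer C) u v ≡ true
      edges u v uv with interior? C u ⊎-dec interior? C v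
      ... | yes i = Sum.assocʳ (inj₁ (cover-edges (uv , i)))
      ... | no ¬i = inj₂ (inj₂ (outer-edge C (uv , ¬i)))

    small-∪ : ∀ C₁ C₂ C → Small C₁ → Small C₂ → Closed C → BoundedBy C W →
              (∀ {v} → Interior C v → Interior C₁ v ⊎ Interior C₂ v) → Small C
    small-∪ C₁ C₂ C small₁ small₂ closed bounded split =
      small-if-covered C small₁ small₂ closed bounded
        (Sum.map (inner-vertex C₁ ∘ inj₁) (inner-vertex C₂ ∘ inj₁) ∘ split)
        (Sum.map (inner-edge C₁) (inner-edge C₂) ∘ split-edge)
      where
      split-edge : ∀ {u v} → Touching C u v → Touching C₁ u v ⊎ Touching C₂ u v
      split-edge (uv , inj₁ iu) = Sum.map (λ i → uv , inj₁ i) (λ i → uv , inj₁ i) (split iu)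
      split-edge (uv , inj₂ iv) = Sum.map (λ i → uv , inj₂ i) (λ i → uv , inj₂ i) (split iv)

    small-beside-big : ∀ C₁ C → Big C₁ → Closed C → BoundedBy C W →
                       (∀ {v} → Interior C v ⊎ Boundary C v → ¬ Interior C₁ v) → Small C
    small-beside-big C₁ C big closed bounded apart =
      small-if-covered C big big closed bounded
        (λ i → inj₁ (outer-vertex C₁ (inj₁ (apart (inj₁ i)))))
        (λ t@(uv , _) → let (eu , ev) = touching-ends C closed t
                        in inj₁ (outer-edge C₁ (uv , [ apart eu , apart ev ]′)))

    Fits : Cut n → Set
    Fits C = Small C × Closed C × BoundedBy C W

    small-⋃ : ∀ {I : Set} C₀ (C : I → Cut n) is →
              Fits C₀ → All (Fits ∘ C) is → Small (⋃-cut C₀ C is W)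
    small-⋃ C₀ C [] (small₀ , fit₀) [] =
      small-∪ C₀ C₀ (⋃-cut C₀ C [] W) small₀ small₀ (⋃-closed C₀ C fit₀ []) id [ inj₁ , (λ ()) ]′
    small-⋃ C₀ C (i ∷ is) fit₀@(_ , fit₀′) ((small , fit) ∷ fits) =
      small-∪ (⋃-cut C₀ C is W) (C i) (⋃-cut C₀ C (i ∷ is) W)
        (small-⋃ C₀ C is fit₀ fits) small (⋃-closed C₀ C fit₀′ (fit ∷ All.map proj₂ fits)) id
        λ { (inj₁ i₀)          → inj₁ (inj₁ i₀)
          ; (inj₂ (here x))    → inj₂ x
          ; (inj₂ (there x))   → inj₁ (inj₂ x) }

-- Tree decompositions

module Decomposition {n : ℕ} {G : Graph n} {S : Subset n} (D : TreeDecomp G S) where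

  open TreeDecomp D
  open Separations G
  open TreeSides tree

  private
    variable
      u v w : Fin n
      r s t x : Node tree

  Attached : Fin n → Fin n → Set
  Attached v u = u ∈ X × ∃ λ w → ReachOutside G X v w × w ~ u

  attached? : ∀ v u → Dec (Attached v u)
  attached? v u = (u ∈? X) ×-dec any? λ w → walk? (λ x → ¬? (x ∈? X)) v w ×-dec (w ~? u)

  attached-neighbour : v ∉ X → v ~ u → u ∈ X → Attached v u
  attached-neighbour v∉X vu u∈X = u∈X , _ , here v∉X , vu

  attached-step : u ∉ X → u ~ v → Attached v w → Attached u w
  attached-step u∉X uv (w∈X , x , vx , xw) = w∈X , x , step u∉X uv vx , xw

  anchor : v ∉ X → Node tree
  anchor {v} v∉X = proj₁ (compNbrs v v∉X)

  attached⊆anchor : (v∉X : v ∉ X) → Attached v u → u ∈ bag (anchor v∉X)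
  attached⊆anchor {v} v∉X (u∈X , w , vw , wu) =
    proj₂ (compNbrs v v∉X) _ (w , vw , (λ vu → last∈ vu u∈X) , wu)

  InSideBag : Node tree → Node tree → Pred (Fin n) 0ℓ
  InSideBag s t u = u ∉ bag t × ∃ λ x → Side s t x × u ∈ bag x

  InSide : Node tree → Node tree → Pred (Fin n) 0ℓ
  InSide s t v = InSideBag s t v ⊎ (v ∉ X × ∃ λ u → Attached v u × InSideBag s t u)

  Shared : Node tree → Node tree → Pred (Fin n) 0ℓ
  Shared s t v = v ∈ bag s × v ∈ bag t

  Hanging : Node tree → Pred (Fin n) 0ℓ
  Hanging t v = v ∉ X × (∀ u → Attached v u → u ∈ bag t)

  inSideBag? : ∀ s t → Decidable (InSideBag s t)
  inSideBag? s t u = ¬? (u ∈? bag t) ×-dec any? λ x → side? s t x ×-dec (u ∈? bag x)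

  inSide? : ∀ s t → Decidable (InSide s t)
  inSide? s t v =
    inSideBag? s t v ⊎-dec (¬? (v ∈? X) ×-dec any? λ u → attached? v u ×-dec inSideBag? s t u)

  shared? : ∀ s t → Decidable (Shared s t)
  shared? s t v = (v ∈? bag s) ×-dec (v ∈? bag t)

  hanging? : ∀ t → Decidable (Hanging t)
  hanging? t v = ¬? (v ∈? X) ×-dec all? λ u → attached? v u →-dec (u ∈? bag t)

  sideCut : Node tree → Node tree → Cut n
  sideCut s t = cut (inSide? s t) (shared? s t)

  hangingCut : Node tree → Cut n
  hangingCut t = cut (hanging? t) (_∈? bag t)

  inSideBag⇒side : InSideBag s t u → u ∈ bag r → Side s t r
  inSideBag⇒side {t = t} (u∉t , x , sx , u∈x) u∈r =
    sx ++ weaken (λ u∈y y≡t → u∉t (subst (λ y → _ ∈ bag y) y≡t u∈y))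
                 (vtxConn _ (bag⊆X x u∈x) x _ u∈x u∈r)

  -- The bags containing u form a subtree, which reaches the s-side from t only through s.
  ∈bag-t∩side⇒∈bag-s : s ⌢ t → u ∈ bag t → Side s t x → u ∈ bag x → u ∈ bag s
  ∈bag-t∩side⇒∈bag-s {u = u} st u∈t sx u∈x with last-exit (vtxConn u (bag⊆X _ u∈t) _ _ u∈t u∈x)
  ... | inj₁ refl = ⊥-elim (last∈ sx refl)
  ... | inj₂ (y , ty , yx) =
    subst (λ z → u ∈ bag z)
          (side∧⌢⇒≡ st (sx ++ reverse (tadj-sym tree) (weaken proj₂ yx)) (⌢-sym ty))
          (proj₁ (head∈ yx))

  side-bag⇒inSide⊎shared : s ⌢ t → Side s t r → v ∈ bag r → InSide s t v ⊎ Shared s t v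
  side-bag⇒inSide⊎shared {t = t} {v = v} st sr v∈r with v ∈? bag t
  ... | yes v∈t = inj₂ (∈bag-t∩side⇒∈bag-s st v∈t sr v∈r , v∈t)
  ... | no v∉t  = inj₁ (inj₁ (v∉t , _ , sr , v∈r))

  sideCut-closed : s ⌢ t → Closed (sideCut s t)
  sideCut-closed st {u} {v} uv (inj₁ b@(_ , x , _ , u∈x)) with v ∈? X
  ... | yes v∈X = let (r , u∈r , v∈r) = edgeCov u v (bag⊆X x u∈x) v∈X uv
                  in side-bag⇒inSide⊎shared st (inSideBag⇒side b u∈r) v∈r
  ... | no v∉X  = inj₁ (inj₂ (v∉X , u , attached-neighbour v∉X (~-sym uv) (bag⊆X x u∈x) , b))
  sideCut-closed st {u} {v} uv (inj₂ (u∉X , w , att , b)) with v ∈? X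
  ... | yes v∈X = side-bag⇒inSide⊎shared st (inSideBag⇒side b (attached⊆anchor u∉X att))
                    (attached⊆anchor u∉X (attached-neighbour u∉X uv v∈X))
  ... | no v∉X  = inj₁ (inj₂ (v∉X , w , attached-step v∉X (~-sym uv) att , b))

  hangingCut-closed : Closed (hangingCut t)
  hangingCut-closed {u = u} {v} uv (u∉X , attached⊆t) with v ∈? X
  ... | yes v∈X = inj₂ (attached⊆t v (attached-neighbour u∉X uv v∈X))
  ... | no v∉X  = inj₁ (v∉X , λ w att → attached⊆t w (attached-step u∉X uv att))

  home : Fin n → Node tree
  home v with v ∈? X
  ... | yes v∈X = proj₁ (vtxNonempty v v∈X)
  ... | no v∉X  = anchor v∉X

  inSide⇒side-home : InSide s t v → Side s t (home v)
  inSide⇒side-home {v = v} i with v ∈? X | i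
  ... | yes v∈X | inj₁ b                 = inSideBag⇒side b (proj₂ (vtxNonempty v v∈X))
  ... | yes v∈X | inj₂ (v∉X , _)         = ⊥-elim (v∉X v∈X)
  ... | no v∉X  | inj₁ (_ , x , _ , v∈x) = ⊥-elim (v∉X (bag⊆X x v∈x))
  ... | no v∉X  | inj₂ (_ , _ , att , b) = inSideBag⇒side b (attached⊆anchor v∉X att)

  inSide⇒∉bag : InSide s t v → v ∉ bag t
  inSide⇒∉bag         (inj₁ (v∉t , _)) = v∉t
  inSide⇒∉bag {t = t} (inj₂ (v∉X , _)) = v∉X ∘ bag⊆X t

  inSide-disjoint : s ⌢ t → InSide t s v ⊎ Shared t s v → ¬ InSide s t v
  inSide-disjoint st (inj₁ ts)        st′ =
    sides-disjoint st (inSide⇒side-home st′) (inSide⇒side-home ts)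
  inSide-disjoint st (inj₂ (v∈t , _)) st′ = inSide⇒∉bag st′ v∈t

  ∉bag⇒inSideBag : u ∈ X → u ∉ bag t → ∃ λ s → s ⌢ t × InSideBag s t u
  ∉bag⇒inSideBag {u} {t} u∈X u∉t with vtxNonempty u u∈X
  ... | x , u∈x with ≡⊎side t x
  ...   | inj₁ refl          = ⊥-elim (u∉t u∈x)
  ...   | inj₂ (s , ts , sx) = s , ⌢-sym ts , u∉t , x , sx , u∈x

  bag⊎hanging⊎inSide : ∀ t v → v ∈ bag t ⊎ Hanging t v ⊎ ∃ λ s → s ⌢ t × InSide s t v
  bag⊎hanging⊎inSide t v with v ∈? bag t | v ∈? X
  ... | yes v∈t | _       = inj₁ v∈t
  ... | no v∉t  | yes v∈X = let (s , st , b) = ∉bag⇒inSideBag v∈X v∉t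
                            in inj₂ (inj₂ (s , st , inj₁ b))
  ... | no v∉t  | no v∉X with any? (λ u → attached? v u ×-dec ¬? (u ∈? bag t))
  ...   | yes (u , att , u∉t) = let (s , st , b) = ∉bag⇒inSideBag (proj₁ att) u∉t
                                in inj₂ (inj₂ (s , st , inj₂ (v∉X , u , att , b)))
  ...   | no none = inj₂ (inj₁ (v∉X , λ u att →
                      decidable-stable (u ∈? bag t) λ u∉t → none (u , att , u∉t)))

module _ {n : ℕ} {G : Graph n} {S : Subset n} {k : ℕ} {𝒯 : Sub n → Sub n → Set}
         (tangle : IsTangleOf G S k 𝒯) (D : TreeDecomp G S) where

  open TreeDecomp D
  open Separations G
  open TangleFacts G S k 𝒯 tangle
  open TreeSides tree
  open Decomposition D

  no-tangle-with-small-bags : (∀ t → ∣ bag t ∣ ≤ k ∸ 1) → ⊥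
  no-tangle-with-small-bags small-bags = at-sink (proj₂ (sink sides-oriented))
    where
    sides-oriented : ∀ {s t} → s ⌢ t → Small (sideCut s t) ⊎ Small (sideCut t s)
    sides-oriented {s} {t} st
      with small⊎big (bag t) (small-bags t) (sideCut s t) (sideCut-closed st) proj₂
    ... | inj₁ small = inj₁ small
    ... | inj₂ big   = inj₂ (small-beside-big (bag s) (small-bags s) (sideCut s t) (sideCut t s) big
                               (sideCut-closed (⌢-sym st)) proj₂ (inSide-disjoint st))

    hanging-small : ∀ t → Small (hangingCut t)
    hanging-small t = small-if-avoids-S (bag t) (small-bags t) (hangingCut t) hangingCut-closed id
                        λ v∈S (v∉X , _) → v∉X (S⊆X v∈S)

    at-sink : ∀ {t} → IsSink sides-oriented t → ⊥
    at-sink {t} inward = ¬small-spanning around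
      (small-⋃ (bag t) (small-bags t) (hangingCut t) (λ s → sideCut s t) neighbours
         (hanging-small t , hangingCut-closed , id)
         fits)
      covered
      where
      neighbours : List (Node tree)
      neighbours = filter (_⌢? t) (allFin _)

      fits : All (λ s → Fits (bag t) (small-bags t) (sideCut s t)) neighbours
      fits = All.map fit (all-filter (_⌢? t) (allFin _))
        where
        fit : ∀ {s} → s ⌢ t → Fits (bag t) (small-bags t) (sideCut s t)
        fit st = inward _ st , sideCut-closed st , proj₂

      around : Cut n
      around = ⋃-cut (hangingCut t) (λ s → sideCut s t) neighbours (bag t)

      covered : ∀ v → Interior around v ⊎ Boundary around v
      covered v with bag⊎hanging⊎inSide t v
      ... | inj₁ v∈t                = inj₂ v∈t
      ... | inj₂ (inj₁ h)           = inj₁ (inj₁ h)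
      ... | inj₂ (inj₂ (s , st , i)) = inj₁ (inj₂ (lose (∈-filter⁺ (_⌢? t) (∈-allFin s) st) i))

∣bag∣≤1+width : ∀ {n} (G : Graph n) {S} (D : TreeDecomp G S) t →
                ∣ TreeDecomp.bag D t ∣ ≤ suc (width G D)
∣bag∣≤1+width G D t =
  ≤-trans (≤-foldr-⊔ (∈-map⁺ (λ t → ∣ TreeDecomp.bag D t ∣) (∈-allFin t))) (m≤n+m∸n _ 1)

lemma6p3 : (k n : ℕ) → 1 ≤ k → 1 ≤ n → (G : Graph n) → (S : Subset n) →
    TnAtLeast G S k → TwAtLeast G S (k ∸ 1)
lemma6p3 k n _ _ G S (k′ , k≤k′ , 𝒯 , tangle) D with k ∸ 1 ≤? width G D
... | yes k-1≤width = k-1≤width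
... | no k-1≰width  = ⊥-elim (no-tangle-with-small-bags tangle D λ t →
        ≤-trans (∣bag∣≤1+width G D t) (≤-trans (≰⇒> k-1≰width) (∸-monoˡ-≤ 1 k≤k′)))
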